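{- Let $r\le d$ be positive integers and $s$ a positive integer. Let $X_{d,r,s}$ be the family of finite subsets $\beta$ of the positive integers such that (1) $x-s\in\beta$ for all $x\in\beta$ with $x\ge s$; (2) $x-(s+r)\in\beta$ for all $x\in\beta$ with $x\ge s+r$; (3) $|x-y|>d$ for all distinct $x,y\in\beta$. Then every $\beta\in X_{d,r,s}$ satisfies $\beta\subseteq\{1,2,\dots,s+r-1\}\setminus\{s\}$. In particular, when $r=1$, every $\beta\in X_{d,1,s}$ satisfies $\beta\subseteq\{1,2,\dots,s-1\}$. -}

module Defs where

open import Data.Nat using (ℕ; _≤_; _<_; _≥_; _>_; _∸_; _+_; ∣_-_∣)
open import Data.List using (List)
open import Data.List.Membership.Propositional using (_∈_)
open import Relation.Binary.PropositionalEquality using (_≢_)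
open import Data.Product using (_×_)

-- A finite subset β of the positive integers is represented by a list of
-- naturals all of which are ≥ 1 (duplicates/order are irrelevant, only
-- membership _∈_ is used).
record InX (d r s : ℕ) (β : List ℕ) : Set where
  field
    positive : ∀ {x} → x ∈ β → 1 ≤ x
    cond1    : ∀ {x} → x ∈ β → x ≥ s → (x ∸ s) ∈ β
    cond2    : ∀ {x} → x ∈ β → x ≥ s + r → (x ∸ (s + r)) ∈ β
    cond3    : ∀ {x y} → x ∈ β → y ∈ β → x ≢ y → ∣ x - y ∣ > d

-- If s ∈ β, condition (1) would put s − s = 0 in β.  If some x ≥ s + r
-- lay in β, then by (1) and (2) both x − s and x − s − r lie in β; they are
-- distinct (r ≥ 1) yet only r ≤ d apart, contradicting (3).
module Submission where

open import Defs
open import Data.Nat using (ℕ; _≤_; _<_; _∸_; _+_; ∣_-_∣; s≤s)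
open import Data.Nat.Properties
open import Data.List using (List)
open import Data.List.Membership.Propositional using (_∈_)
open import Relation.Binary.PropositionalEquality
open import Data.Product using (_×_; _,_)

<⇒≤∸1 : ∀ {m n} → m < n → m ≤ n ∸ 1
<⇒≤∸1 (s≤s m≤n) = m≤n

∣m-[m∸n]∣≡n : ∀ {m n} → n ≤ m → ∣ m - (m ∸ n) ∣ ≡ n
∣m-[m∸n]∣≡n {m} {n} n≤m = trans (m≤n⇒∣n-m∣≡n∸m (m∸n≤m m n)) (m∸[m∸n]≡n n≤m)

module _ {d r s : ℕ} {β : List ℕ} (X : InX d r s β) where
  open InX X

  ∈⇒≢s : ∀ {x} → x ∈ β → x ≢ s
  ∈⇒≢s {x} x∈β refl with positive (subst (_∈ β) (n∸n≡0 x) (cond1 x∈β ≤-refl))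
  ... | ()

  ∈∧∸∈⇒d<gap : ∀ {y n} → 1 ≤ n → n ≤ y → y ∈ β → y ∸ n ∈ β → d < n
  ∈∧∸∈⇒d<gap {y} {n} 1≤n n≤y y∈β y∸n∈β =
    subst (d <_) (∣m-[m∸n]∣≡n n≤y) (cond3 y∈β y∸n∈β y≢y∸n)
    where
    y≢y∸n : y ≢ y ∸ n
    y≢y∸n = >⇒≢ (∸-monoʳ-< {y} 1≤n n≤y)

  ∈⇒<s+r : 1 ≤ r → r ≤ d → ∀ {x} → x ∈ β → x < s + r
  ∈⇒<s+r 1≤r r≤d {x} x∈β = ≰⇒> λ s+r≤x →
    <⇒≱ (∈∧∸∈⇒d<gap 1≤r (r≤x∸s s+r≤x) (x∸s∈β s+r≤x) (x∸s∸r∈β s+r≤x)) r≤d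
    where
    r≤x∸s : s + r ≤ x → r ≤ x ∸ s
    r≤x∸s s+r≤x = m+n≤o⇒m≤o∸n r (≤-trans (≤-reflexive (+-comm r s)) s+r≤x)
    x∸s∈β : s + r ≤ x → x ∸ s ∈ β
    x∸s∈β s+r≤x = cond1 x∈β (m+n≤o⇒m≤o s s+r≤x)
    x∸s∸r∈β : s + r ≤ x → x ∸ s ∸ r ∈ β
    x∸s∸r∈β s+r≤x = subst (_∈ β) (sym (∸-+-assoc x s r)) (cond2 x∈β s+r≤x)

lemma2p5 : (∀ (d r s : ℕ) → 1 ≤ r → r ≤ d → 1 ≤ s → (β : List ℕ) → InX d r s β → ∀ {x} → x ∈ β → (1 ≤ x × x ≤ s + r ∸ 1 × x ≢ s)) × (∀ (d s : ℕ) → 1 ≤ d → 1 ≤ s → (β : List ℕ) → InX d 1 s β → ∀ {x} → x ∈ β → (1 ≤ x × x ≤ s ∸ 1))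
lemma2p5 = general , rankOne
  where
  general : ∀ (d r s : ℕ) → 1 ≤ r → r ≤ d → 1 ≤ s → (β : List ℕ) → InX d r s β → ∀ {x} → x ∈ β → (1 ≤ x × x ≤ s + r ∸ 1 × x ≢ s)
  general d r s 1≤r r≤d _ β X x∈β =
    InX.positive X x∈β , <⇒≤∸1 (∈⇒<s+r X 1≤r r≤d x∈β) , ∈⇒≢s X x∈β

  rankOne : ∀ (d s : ℕ) → 1 ≤ d → 1 ≤ s → (β : List ℕ) → InX d 1 s β → ∀ {x} → x ∈ β → (1 ≤ x × x ≤ s ∸ 1)
  rankOne d s 1≤d _ β X {x} x∈β = InX.positive X x∈β , <⇒≤∸1 x<s
    where
    x≤s : x ≤ s
    x≤s = m<1+n⇒m≤n (subst (x <_) (+-comm s 1) (∈⇒<s+r X ≤-refl 1≤d x∈β))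
    x<s : x < s
    x<s = ≤∧≢⇒< x≤s (∈⇒≢s X x∈β)
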